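{- Let $p>2$ be a prime and let $A\subset\mathbb{Z}_p$ with $|A|\geq5$. Define $A_1=A$ and, for integers $k\geq2$, $A_k=N_kA^k-N_kA^k$ where $N_k=\frac5{24}4^k-\frac13$. Then for every positive integer $k$, $$|A_k|\geq\frac38\min\left(|A|^k,\frac{p-1}2\right).$$
   Context: $\mathbb{Z}_p$ is the field of residues modulo $p$. $A^k=\{a_1\cdots a_k:\ a_i\in A\}$, $NS=\{s_1+\dots+s_N:\ s_i\in S\}$, and $S-T=\{s-t:\ s\in S, t\in T\}$. Note $N_k$ is a positive integer for $k\geq2$. -}

module Defs where

open import Data.Nat using (ℕ; zero; suc; _+_; _*_; _∸_; _^_; NonZero)
open import Data.Nat.DivMod using (_mod_; _/_)
open import Data.Fin using (Fin; toℕ)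
open import Data.Fin.Properties using (_≟_)
open import Data.Fin.Subset using (Subset; ⁅_⁆)
open import Data.Bool using (Bool; _∧_)
open import Data.Bool.ListAction using (any)
open import Data.List.Base using (allFin)
open import Data.Vec using (lookup; tabulate)
open import Relation.Nullary.Decidable using (⌊_⌋)

module _ (p : ℕ) .{{_ : NonZero p}} where

  zeroₚ oneₚ : Fin p
  zeroₚ = 0 mod p
  oneₚ  = 1 mod p

  _+ₚ_ _*ₚ_ _-ₚ_ : Fin p → Fin p → Fin p
  x +ₚ y = (toℕ x + toℕ y) mod p
  x *ₚ y = (toℕ x * toℕ y) mod p
  x -ₚ y = (toℕ x + (p ∸ toℕ y)) mod p

  setOp : (Fin p → Fin p → Fin p) → Subset p → Subset p → Subset p
  setOp op S T = tabulate λ z →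
    any (λ x → any (λ y → lookup S x ∧ lookup T y ∧ ⌊ op x y ≟ z ⌋) (allFin p)) (allFin p)

  prodSet sumSet diffSet : Subset p → Subset p → Subset p
  prodSet = setOp _*ₚ_
  sumSet  = setOp _+ₚ_
  diffSet = setOp _-ₚ_

  powSet : Subset p → ℕ → Subset p
  powSet A zero    = ⁅ oneₚ ⁆
  powSet A (suc k) = prodSet (powSet A k) A

  multSet : ℕ → Subset p → Subset p
  multSet zero    S = ⁅ zeroₚ ⁆
  multSet (suc N) S = sumSet (multSet N S) S

-- N_k = (5/24) 4^k - 1/3 = (5·4^k - 8)/24  (exact division for k ≥ 2)
Nk : ℕ → ℕ
Nk k = (5 * 4 ^ k ∸ 8) / 24

-- A_1 = A, A_k = N_k A^k - N_k A^k for k ≥ 2 (A_0 := A, never used)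
Aseq : (p : ℕ) .{{_ : NonZero p}} → Subset p → ℕ → Subset p
Aseq p A zero          = A
Aseq p A (suc zero)    = A
Aseq p A k@(suc (suc _)) =
  diffSet p (multSet p (Nk k) (powSet p A k)) (multSet p (Nk k) (powSet p A k))

module Submission where

-- Fix X ⊆ A_k and project X × A onto ℤ/p along each direction ξ by (x, y) ↦ x + ξy. If two points
-- collide in direction ξ, then ξ(y₁ − y₂) = x₂ − x₁. Writing each x ∈ X as a difference u − w of sums
-- of N_k elements of A^k (for k = 1, x = x − 0), both dilates (y₁ − y₂)(x + ξy) and
-- (y₁ − y₂)(x + (ξ + t)y), for a fixed nonzero t ∈ A^(k−1), are differences of sums of
-- 4N_k + 1 = N_(k+1) elements of A^(k+1), so they lie in A_(k+1). Two distinct points collide in at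
-- most one direction, so some direction has at most L²/(2p) collisions, where L = |X||A|. If points
-- collide in that direction, A_(k+1) contains a dilate of the projection of X × A; otherwise, walking
-- from the colliding direction 0 towards it in steps of t gives a colliding η with η + t
-- collision-free, and A_(k+1) contains an injective dilate of X × A. Either way
-- |A_(k+1)| ≥ L − L²/(2p). Choosing |X| suitably, this recursion keeps |A_k| ≥ (3/8)|A|^k while
-- |A|^k ≤ p, and gives |A_k| ≥ 7p/32 once |A|^k > p, by taking L in [p/4, p].

open import Defs
open import Algebra.Bundles using (CommutativeRing)
open import Algebra.Structures using (IsCommutativeRing)
import Algebra.Properties.CommutativeSemigroup as CommutativeSemigroupProperties
import Algebra.Properties.Ring as RingProperties
import Algebra.Solver.Ring as RingSolver
open import Algebra.Solver.Ring.AlmostCommutativeRing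
  using (fromCommutativeRing; _-Raw-AlmostCommutative⟶_)
open import Data.Bool using (T)
open import Data.Bool.Properties using (T-≡; T-∧)
open import Data.Fin using (Fin; toℕ; zero; suc)
import Data.Fin.Properties as Fin
open import Data.Fin.Properties using (_≟_; 0≢1+n)
open import Data.Fin.Subset as Subset using (Subset; _∈_; ∣_∣; ⁅_⁆; inside; outside)
open import Data.Fin.Subset.Properties
  using (x∈⁅x⁆; x∈⁅y⁆⇒x≡y; x∈p⇒∣p-x∣<∣p∣; x∈p∧x≢y⇒x∈p-y; ∣p∣≤n)
open import Data.Integer as ℤ using (ℤ; -[1+_]; _⊖_)
import Data.Integer.Properties as ℤ
open import Data.List as List using (List; []; _∷_; allFin; length)
import Data.List.Properties as List
open import Data.List.Membership.Propositional using (find; lose) renaming (_∈_ to _∈ₗ_)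
open import Data.List.Membership.Propositional.Properties
  using (∈-allFin; ∈-cartesianProduct⁺; ∈-cartesianProduct⁻)
open import Data.List.Relation.Unary.All as All using (All; []; _∷_)
import Data.List.Relation.Unary.All.Properties as All
open import Data.List.Relation.Unary.AllPairs using ([]; _∷_)
open import Data.List.Relation.Unary.Any using (Any; here; there; any?)
open import Data.List.Relation.Unary.Any.Properties using (any⁺; any⁻)
open import Data.List.Relation.Unary.Unique.Propositional using (Unique)
import Data.List.Relation.Unary.Unique.Propositional.Properties as Unique
open import Data.Maybe using (Maybe; just; nothing)
open import Data.Nat using (ℕ; zero; suc; NonZero; _∸_; _%_; _^_; _⊓_)
import Data.Nat as ℕ
import Data.Nat.Properties as ℕ
open import Data.Nat.Base using (nonTrivial⇒n>1)
open import Data.Nat.Combinatorics using (_C_; nC1≡n; nCk+nC[k+1]≡[n+1]C[k+1])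
open import Data.Nat.Coprimality using (prime⇒coprime; coprime-Bézout)
open import Data.Nat.Divisibility using (_∣_; ∣-refl; n∣m*n; m%n≡0⇒n∣m; n∣m⇒m%n≡0)
open import Data.Nat.DivMod using (_mod_; _/_; %-distribˡ-+; %-distribˡ-*; m<n⇒m%n≡m; m*n/n≡m)
open import Data.Nat.GCD using (module Bézout)
open import Data.Nat.Primality using (Prime; euclidsLemma; prime⇒nonTrivial)
open import Data.Nat.Tactic.RingSolver using (solve-∀)
open import Algebra.Properties.CommutativeMonoid.Sum ℕ.+-0-commutativeMonoid
  using (sum-syntax; ∑-distrib-+; sum-replicate-zero)
open import Data.Product using (∃; ∃₂; _×_; _,_; proj₁; proj₂; uncurry)
open import Data.Product.Properties using (≡-dec)
open import Data.Sum as Sum using (_⊎_; inj₁; inj₂; [_,_]′)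
open import Data.Vec using (lookup; []; _∷_)
import Data.Vec as Vec
open import Data.Vec.Properties using (lookup∘tabulate; []=⇒lookup; lookup⇒[]=)
open import Function using (_∘_; flip; id)
open import Function.Bundles using (Equivalence)
open import Relation.Binary.PropositionalEquality
open import Relation.Nullary using (Dec; yes; no; ¬_; contradiction)
open import Relation.Nullary.Decidable using (toWitness; fromWitness; ¬?; _×-dec_)
open import Relation.Unary using (Decidable)

module Residues (p : ℕ) .{{_ : NonZero p}} where

  infixl 6 _+_
  infixl 7 _*_
  infix  8 -_

  _+_ _*_ : Fin p → Fin p → Fin p
  _+_ = _+ₚ_ p
  _*_ = _*ₚ_ p

  0# 1# : Fin p
  0# = zeroₚ p
  1# = oneₚ p

  -_ : Fin p → Fin p
  - x = (p ∸ toℕ x) mod p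

  π : ℕ → Fin p
  π m = m mod p

  toℕ-π : ∀ m → toℕ (π m) ≡ m % p
  toℕ-π m = Fin.toℕ-fromℕ< _

  toℕ-0# : toℕ 0# ≡ 0
  toℕ-0# = trans (toℕ-π 0) (m<n⇒m%n≡m (ℕ.>-nonZero⁻¹ p))

  π-toℕ : ∀ x → π (toℕ x) ≡ x
  π-toℕ x = Fin.toℕ-injective (trans (toℕ-π (toℕ x)) (m<n⇒m%n≡m (Fin.toℕ<n x)))

  π≡0#⇒∣ : ∀ {m} → π m ≡ 0# → p ∣ m
  π≡0#⇒∣ {m} πm≡0 = m%n≡0⇒n∣m m p (trans (sym (toℕ-π m)) (trans (cong toℕ πm≡0) toℕ-0#))

  ∣⇒π≡0# : ∀ {m} → p ∣ m → π m ≡ 0#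
  ∣⇒π≡0# {m} p∣m = Fin.toℕ-injective (trans (toℕ-π m) (trans (n∣m⇒m%n≡0 m p p∣m) (sym toℕ-0#)))

  open ≡-Reasoning

  π-+ : ∀ m n → π (m ℕ.+ n) ≡ π m + π n
  π-+ m n = Fin.toℕ-injective (begin
    toℕ (π (m ℕ.+ n))                ≡⟨ toℕ-π (m ℕ.+ n) ⟩
    (m ℕ.+ n) % p                    ≡⟨ %-distribˡ-+ m n p ⟩
    (m % p ℕ.+ n % p) % p            ≡⟨ cong₂ (λ a b → (a ℕ.+ b) % p) (toℕ-π m) (toℕ-π n) ⟨
    (toℕ (π m) ℕ.+ toℕ (π n)) % p    ≡⟨ toℕ-π _ ⟨
    toℕ (π m + π n)                  ∎)

  π-* : ∀ m n → π (m ℕ.* n) ≡ π m * π n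
  π-* m n = Fin.toℕ-injective (begin
    toℕ (π (m ℕ.* n))                ≡⟨ toℕ-π (m ℕ.* n) ⟩
    (m ℕ.* n) % p                    ≡⟨ %-distribˡ-* m n p ⟩
    (m % p ℕ.* (n % p)) % p          ≡⟨ cong₂ (λ a b → (a ℕ.* b) % p) (toℕ-π m) (toℕ-π n) ⟨
    (toℕ (π m) ℕ.* toℕ (π n)) % p    ≡⟨ toℕ-π _ ⟨
    toℕ (π m * π n)                  ∎)

  π-*-toℕ : ∀ m x → π (m ℕ.* toℕ x) ≡ π m * x
  π-*-toℕ m x = trans (π-* m (toℕ x)) (cong (π m *_) (π-toℕ x))

  π-*p : ∀ m → π (m ℕ.* p) ≡ 0#
  π-*p m = ∣⇒π≡0# (n∣m*n m)

  π-elim : ∀ {P : Fin p → Set} → (∀ m → P (π m)) → ∀ x → P x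
  π-elim {P} P∘π x = subst P (π-toℕ x) (P∘π (toℕ x))

  +-comm : ∀ x y → x + y ≡ y + x
  +-comm = π-elim λ a → π-elim λ b → begin
    π a + π b            ≡⟨ π-+ a b ⟨
    π (a ℕ.+ b)          ≡⟨ cong π (ℕ.+-comm a b) ⟩
    π (b ℕ.+ a)          ≡⟨ π-+ b a ⟩
    π b + π a            ∎

  +-assoc : ∀ x y z → (x + y) + z ≡ x + (y + z)
  +-assoc = π-elim λ a → π-elim λ b → π-elim λ c → begin
    (π a + π b) + π c    ≡⟨ cong (_+ π c) (π-+ a b) ⟨
    π (a ℕ.+ b) + π c    ≡⟨ π-+ (a ℕ.+ b) c ⟨
    π (a ℕ.+ b ℕ.+ c)    ≡⟨ cong π (ℕ.+-assoc a b c) ⟩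
    π (a ℕ.+ (b ℕ.+ c))  ≡⟨ π-+ a (b ℕ.+ c) ⟩
    π a + π (b ℕ.+ c)    ≡⟨ cong (π a +_) (π-+ b c) ⟩
    π a + (π b + π c)    ∎

  +-identityˡ : ∀ x → 0# + x ≡ x
  +-identityˡ = π-elim λ a → sym (π-+ 0 a)

  *-comm : ∀ x y → x * y ≡ y * x
  *-comm = π-elim λ a → π-elim λ b → begin
    π a * π b            ≡⟨ π-* a b ⟨
    π (a ℕ.* b)          ≡⟨ cong π (ℕ.*-comm a b) ⟩
    π (b ℕ.* a)          ≡⟨ π-* b a ⟩
    π b * π a            ∎

  *-assoc : ∀ x y z → (x * y) * z ≡ x * (y * z)
  *-assoc = π-elim λ a → π-elim λ b → π-elim λ c → begin
    (π a * π b) * π c    ≡⟨ cong (_* π c) (π-* a b) ⟨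
    π (a ℕ.* b) * π c    ≡⟨ π-* (a ℕ.* b) c ⟨
    π (a ℕ.* b ℕ.* c)    ≡⟨ cong π (ℕ.*-assoc a b c) ⟩
    π (a ℕ.* (b ℕ.* c))  ≡⟨ π-* a (b ℕ.* c) ⟩
    π a * π (b ℕ.* c)    ≡⟨ cong (π a *_) (π-* b c) ⟩
    π a * (π b * π c)    ∎

  *-identityˡ : ∀ x → 1# * x ≡ x
  *-identityˡ = π-elim λ a → trans (sym (π-* 1 a)) (cong π (ℕ.*-identityˡ a))

  *-distribʳ-+ : ∀ x y z → (y + z) * x ≡ y * x + z * x
  *-distribʳ-+ = π-elim λ a → π-elim λ b → π-elim λ c → begin
    (π b + π c) * π a            ≡⟨ cong (_* π a) (π-+ b c) ⟨
    π (b ℕ.+ c) * π a            ≡⟨ π-* (b ℕ.+ c) a ⟨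
    π ((b ℕ.+ c) ℕ.* a)          ≡⟨ cong π (ℕ.*-distribʳ-+ a b c) ⟩
    π (b ℕ.* a ℕ.+ c ℕ.* a)      ≡⟨ π-+ (b ℕ.* a) (c ℕ.* a) ⟩
    π (b ℕ.* a) + π (c ℕ.* a)    ≡⟨ cong₂ _+_ (π-* b a) (π-* c a) ⟩
    π b * π a + π c * π a        ∎

  -‿inverseˡ : ∀ x → - x + x ≡ 0#
  -‿inverseˡ x = begin
    - x + x                      ≡⟨ cong (- x +_) (π-toℕ x) ⟨
    π (p ∸ toℕ x) + π (toℕ x)    ≡⟨ π-+ (p ∸ toℕ x) (toℕ x) ⟨
    π (p ∸ toℕ x ℕ.+ toℕ x)      ≡⟨ cong π (ℕ.m∸n+n≡m (ℕ.<⇒≤ (Fin.toℕ<n x))) ⟩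
    π p                          ≡⟨ ∣⇒π≡0# ∣-refl ⟩
    0#                           ∎

  isCommutativeRing : IsCommutativeRing _≡_ _+_ _*_ -_ 0# 1#
  isCommutativeRing = record
    { isRing = record
      { +-isAbelianGroup = record
        { isGroup = record
          { isMonoid = record
            { isSemigroup = record
              { isMagma = record { isEquivalence = isEquivalence ; ∙-cong = cong₂ _+_ }
              ; assoc   = +-assoc
              }
            ; identity = +-identityˡ , λ x → trans (+-comm x 0#) (+-identityˡ x)
            }
          ; inverse = -‿inverseˡ , λ x → trans (+-comm x (- x)) (-‿inverseˡ x)
          ; ⁻¹-cong = cong -_
          }
        ; comm = +-comm
        }
      ; *-cong     = cong₂ _*_
      ; *-assoc    = *-assoc
      ; *-identity = *-identityˡ , λ x → trans (*-comm x 1#) (*-identityˡ x)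
      ; distrib    = (λ x y z → trans (*-comm x (y + z))
                                  (trans (*-distribʳ-+ x y z) (cong₂ _+_ (*-comm y x) (*-comm z x))))
                   , *-distribʳ-+
      }
    ; *-comm = *-comm
    }

  ring : CommutativeRing _ _
  ring = record { isCommutativeRing = isCommutativeRing }

  open CommutativeRing ring public using (_-_; +-identityʳ; zeroˡ)
  open RingProperties (CommutativeRing.ring ring)
    using (-0#≈0#; -‿involutive; -‿+-comm; -‿distribˡ-*; -‿distribʳ-*)
  open CommutativeSemigroupProperties (CommutativeRing.+-commutativeSemigroup ring)
    using () renaming (interchange to +-interchange)

  -ₚ≡- : ∀ x y → _-ₚ_ p x y ≡ x - y
  -ₚ≡- x y = trans (π-+ (toℕ x) (p ∸ toℕ y)) (cong (_+ - y) (π-toℕ x))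

  ⟦_⟧ : ℤ → Fin p
  ⟦ ℤ.+ n ⟧    = π n
  ⟦ -[1+ n ] ⟧ = - π (suc n)

  ⊖-homo : ∀ m n → ⟦ m ⊖ n ⟧ ≡ π m - π n
  ⊖-homo m       zero    = sym (trans (cong (π m +_) -0#≈0#) (+-identityʳ (π m)))
  ⊖-homo zero    (suc n) = sym (+-identityˡ _)
  ⊖-homo (suc m) (suc n) = begin
    ⟦ suc m ⊖ suc n ⟧            ≡⟨ cong ⟦_⟧ (ℤ.[1+m]⊖[1+n]≡m⊖n m n) ⟩
    ⟦ m ⊖ n ⟧                    ≡⟨ ⊖-homo m n ⟩
    π m - π n                    ≡⟨ shift 1# (π m) (π n) ⟩
    (1# + π m) - (1# + π n)      ≡⟨ cong₂ _-_ (π-+ 1 m) (π-+ 1 n) ⟨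
    π (suc m) - π (suc n)        ∎
    where
    shift : ∀ c a b → a - b ≡ (c + a) - (c + b)
    shift c a b = begin
      a + - b                    ≡⟨ +-identityˡ (a + - b) ⟨
      0# + (a + - b)             ≡⟨ cong (_+ (a + - b)) (trans (+-comm c (- c)) (-‿inverseˡ c)) ⟨
      (c + - c) + (a + - b)      ≡⟨ +-interchange c (- c) a (- b) ⟩
      (c + a) + (- c + - b)      ≡⟨ cong ((c + a) +_) (-‿+-comm c b) ⟩
      (c + a) + - (c + b)        ∎

  +-homo : ∀ i j → ⟦ i ℤ.+ j ⟧ ≡ ⟦ i ⟧ + ⟦ j ⟧
  +-homo (ℤ.+ m)  (ℤ.+ n)  = π-+ m n
  +-homo (ℤ.+ m)  -[1+ n ] = ⊖-homo m (suc n)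
  +-homo -[1+ m ] (ℤ.+ n)  = trans (⊖-homo n (suc m)) (+-comm (π n) _)
  +-homo -[1+ m ] -[1+ n ] = begin
    - π (suc (suc (m ℕ.+ n)))    ≡⟨ cong (-_ ∘ π ∘ suc) (ℕ.+-suc m n) ⟨
    - π (suc m ℕ.+ suc n)        ≡⟨ cong -_ (π-+ (suc m) (suc n)) ⟩
    - (π (suc m) + π (suc n))    ≡⟨ -‿+-comm (π (suc m)) (π (suc n)) ⟨
    - π (suc m) + - π (suc n)    ∎

  -‿homo : ∀ i → ⟦ ℤ.- i ⟧ ≡ - ⟦ i ⟧
  -‿homo (ℤ.+ zero)    = sym -0#≈0#
  -‿homo (ℤ.+ (suc n)) = refl
  -‿homo -[1+ n ]      = sym (-‿involutive (π (suc n)))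

  private
    *-homo-+ : ∀ m j → ⟦ ℤ.+ m ℤ.* j ⟧ ≡ π m * ⟦ j ⟧
    *-homo-+ m (ℤ.+ n)  = trans (cong ⟦_⟧ (sym (ℤ.pos-* m n))) (π-* m n)
    *-homo-+ m -[1+ n ] = begin
      ⟦ ℤ.+ m ℤ.* ℤ.- ℤ.+ suc n ⟧      ≡⟨ cong ⟦_⟧ (ℤ.neg-distribʳ-* (ℤ.+ m) (ℤ.+ suc n)) ⟨
      ⟦ ℤ.- (ℤ.+ m ℤ.* ℤ.+ suc n) ⟧    ≡⟨ -‿homo (ℤ.+ m ℤ.* ℤ.+ suc n) ⟩
      - ⟦ ℤ.+ m ℤ.* ℤ.+ suc n ⟧        ≡⟨ cong -_ (*-homo-+ m (ℤ.+ suc n)) ⟩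
      - (π m * π (suc n))              ≡⟨ -‿distribʳ-* (π m) (π (suc n)) ⟩
      π m * - π (suc n)                ∎

  *-homo : ∀ i j → ⟦ i ℤ.* j ⟧ ≡ ⟦ i ⟧ * ⟦ j ⟧
  *-homo (ℤ.+ m)  j = *-homo-+ m j
  *-homo -[1+ m ] j = begin
    ⟦ ℤ.- ℤ.+ suc m ℤ.* j ⟧            ≡⟨ cong ⟦_⟧ (ℤ.neg-distribˡ-* (ℤ.+ suc m) j) ⟨
    ⟦ ℤ.- (ℤ.+ suc m ℤ.* j) ⟧          ≡⟨ -‿homo (ℤ.+ suc m ℤ.* j) ⟩
    - ⟦ ℤ.+ suc m ℤ.* j ⟧              ≡⟨ cong -_ (*-homo-+ (suc m) j) ⟩
    - (π (suc m) * ⟦ j ⟧)              ≡⟨ -‿distribˡ-* (π (suc m)) ⟦ j ⟧ ⟩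
    - π (suc m) * ⟦ j ⟧                ∎

  ℤ-homomorphism : ℤ.+-*-rawRing -Raw-AlmostCommutative⟶ fromCommutativeRing ring
  ℤ-homomorphism = record
    { ⟦_⟧ = ⟦_⟧ ; +-homo = +-homo ; *-homo = *-homo ; -‿homo = -‿homo ; 0-homo = refl ; 1-homo = refl }

  ⟦⟧-≟ : ∀ i j → Maybe (⟦ i ⟧ ≡ ⟦ j ⟧)
  ⟦⟧-≟ i j with i ℤ.≟ j
  ... | yes refl = just refl
  ... | no _     = nothing

  -- The solver normalises with coefficients in ℤ: arithmetic in Fin p does not compute for a
  -- variable p, so coefficients taken in ℤ/p itself could not be compared.
  open RingSolver ℤ.+-*-rawRing (fromCommutativeRing ring) ℤ-homomorphism ⟦⟧-≟ public
    using (solve; _:=_; _:+_; _:*_; _:-_; :-_; con)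

module PrimeField (p : ℕ) .{{_ : NonZero p}} (prime : Prime p) where
  open Residues p public
  open ≡-Reasoning

  1#≢0# : 1# ≢ 0#
  1#≢0# 1≡0 = ℕ.1+n≢0 (begin
    1          ≡⟨ m<n⇒m%n≡m (nonTrivial⇒n>1 p {{prime⇒nonTrivial prime}}) ⟨
    1 % p      ≡⟨ toℕ-π 1 ⟨
    toℕ 1#     ≡⟨ cong toℕ 1≡0 ⟩
    toℕ 0#     ≡⟨ toℕ-0# ⟩
    0          ∎)

  x*y≡0⇒x≡0∨y≡0 : ∀ {x y} → x * y ≡ 0# → x ≡ 0# ⊎ y ≡ 0#
  x*y≡0⇒x≡0∨y≡0 {x} {y} xy≡0 =
    Sum.map p∣toℕ⇒≡0# p∣toℕ⇒≡0# (euclidsLemma (toℕ x) (toℕ y) prime (π≡0#⇒∣ xy≡0))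
    where
    p∣toℕ⇒≡0# : ∀ {z} → p ∣ toℕ z → z ≡ 0#
    p∣toℕ⇒≡0# {z} p∣z = trans (sym (π-toℕ z)) (∣⇒π≡0# p∣z)

  x-y≡0⇒x≡y : ∀ {x y} → x - y ≡ 0# → x ≡ y
  x-y≡0⇒x≡y {x} {y} x-y≡0 = begin
    x              ≡⟨ solve 2 (λ x y → x := (x :- y) :+ y) refl x y ⟩
    (x - y) + y    ≡⟨ cong (_+ y) x-y≡0 ⟩
    0# + y         ≡⟨ +-identityˡ y ⟩
    y              ∎

  x≢y⇒x-y≢0 : ∀ {x y} → x ≢ y → x - y ≢ 0#
  x≢y⇒x-y≢0 x≢y = x≢y ∘ x-y≡0⇒x≡y

  *-cancelˡ : ∀ {c x y} → c ≢ 0# → c * x ≡ c * y → x ≡ y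
  *-cancelˡ {c} {x} {y} c≢0 cx≡cy = [ flip contradiction c≢0 , x-y≡0⇒x≡y ]′ (x*y≡0⇒x≡0∨y≡0 (begin
    c * (x - y)      ≡⟨ solve 3 (λ c x y → c :* (x :- y) := c :* x :- c :* y) refl c x y ⟩
    c * x - c * y    ≡⟨ cong (_- c * y) cx≡cy ⟩
    c * y - c * y    ≡⟨ solve 1 (λ z → z :- z := con (ℤ.+ 0)) refl (c * y) ⟩
    0#               ∎))

  *-≢0 : ∀ {x y} → x ≢ 0# → y ≢ 0# → x * y ≢ 0#
  *-≢0 x≢0 y≢0 = [ x≢0 , y≢0 ]′ ∘ x*y≡0⇒x≡0∨y≡0

  private
    toℕ-nonZero : ∀ {t} → t ≢ 0# → NonZero (toℕ t)
    toℕ-nonZero t≢0 = ℕ.≢-nonZero λ t≡0 → t≢0 (Fin.toℕ-injective (trans t≡0 (sym toℕ-0#)))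

  inverse : ∀ {t} → t ≢ 0# → ∃ λ u → u * t ≡ 1#
  inverse {t} t≢0 with coprime-Bézout (prime⇒coprime prime {{toℕ-nonZero t≢0}} (Fin.toℕ<n t))
  ... | Bézout.+- a b 1+bt≡ap = - π b , (begin
    - π b * t                     ≡⟨ solve 2 (λ b t → :- b :* t := con (ℤ.+ 1) :- (con (ℤ.+ 1) :+ b :* t))
                                             refl (π b) t ⟩
    1# - (1# + π b * t)           ≡⟨ cong (λ z → 1# - (1# + z)) (π-*-toℕ b t) ⟨
    1# - (1# + π (b ℕ.* toℕ t))   ≡⟨ cong (λ z → 1# - z) (π-+ 1 (b ℕ.* toℕ t)) ⟨
    1# - π (1 ℕ.+ b ℕ.* toℕ t)    ≡⟨ cong (λ z → 1# - π z) 1+bt≡ap ⟩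
    1# - π (a ℕ.* p)              ≡⟨ cong (_-_ 1#) (π-*p a) ⟩
    1# - 0#                       ≡⟨ solve 1 (λ u → u :- con (ℤ.+ 0) := u) refl 1# ⟩
    1#                            ∎)
  ... | Bézout.-+ a b 1+ap≡bt = π b , (begin
    π b * t                       ≡⟨ π-*-toℕ b t ⟨
    π (b ℕ.* toℕ t)               ≡⟨ cong π 1+ap≡bt ⟨
    π (1 ℕ.+ a ℕ.* p)             ≡⟨ π-+ 1 (a ℕ.* p) ⟩
    1# + π (a ℕ.* p)              ≡⟨ cong (_+_ 1#) (π-*p a) ⟩
    1# + 0#                       ≡⟨ +-identityʳ 1# ⟩
    1#                            ∎)

  ∃-multiple : ∀ {t} → t ≢ 0# → ∀ ξ → ∃ λ n → π n * t ≡ ξ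
  ∃-multiple {t} t≢0 ξ = let u , ut≡1 = inverse t≢0 in toℕ (ξ * u) , (begin
    π (toℕ (ξ * u)) * t    ≡⟨ cong (_* t) (π-toℕ (ξ * u)) ⟩
    ξ * u * t              ≡⟨ *-assoc ξ u t ⟩
    ξ * (u * t)            ≡⟨ cong (ξ *_) ut≡1 ⟩
    ξ * 1#                 ≡⟨ solve 1 (λ x → x :* con (ℤ.+ 1) := x) refl ξ ⟩
    ξ                      ∎)

  ∃-boundary : ∀ {Q : Fin p → Set} → Decidable Q → ∀ {t} → t ≢ 0# →
               Q 0# → ∀ ξ → ¬ Q ξ → ∃ λ η → Q η × ¬ Q (η + t)
  ∃-boundary {Q} Q? {t} t≢0 Q0 ξ ¬Qξ =
    let n , nt≡ξ = ∃-multiple t≢0 ξ in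
    [ (λ Qnt → contradiction (subst Q nt≡ξ Qnt) ¬Qξ) , id ]′ (walk n)
    where
    step : ∀ n → π n * t + t ≡ π (suc n) * t
    step n = trans (solve 2 (λ m t → m :* t :+ t := (con (ℤ.+ 1) :+ m) :* t) refl (π n) t)
                   (cong (_* t) (sym (π-+ 1 n)))

    extend : ∀ n → Q (π n * t) → Q (π (suc n) * t) ⊎ ∃ λ η → Q η × ¬ Q (η + t)
    extend n Qn with Q? (π n * t + t)
    ... | yes Qn+1 = inj₁ (subst Q (step n) Qn+1)
    ... | no ¬Qn+1 = inj₂ (π n * t , Qn , ¬Qn+1)

    walk : ∀ n → Q (π n * t) ⊎ ∃ λ η → Q η × ¬ Q (η + t)
    walk zero    = inj₁ (subst Q (sym (zeroˡ t)) Q0)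
    walk (suc n) = [ extend n , inj₂ ]′ (walk n)

module SetArithmetic (p : ℕ) .{{_ : NonZero p}} where
  open Residues p

  private
    ∈⇒T : ∀ {S : Subset p} {x} → x ∈ S → T (lookup S x)
    ∈⇒T x∈S = Equivalence.from T-≡ ([]=⇒lookup x∈S)

    T⇒∈ : ∀ {S : Subset p} {x} → T (lookup S x) → x ∈ S
    T⇒∈ {S} {x} Tx = lookup⇒[]= x S (Equivalence.to T-≡ Tx)

    ∈-setOp⁺ : ∀ op {S₁ S₂ : Subset p} {x y} → x ∈ S₁ → y ∈ S₂ → op x y ∈ setOp p op S₁ S₂
    ∈-setOp⁺ op {x = x} {y} x∈S₁ y∈S₂ =
      T⇒∈ (subst T (sym (lookup∘tabulate _ (op x y)))
        (any⁺ _ (lose (∈-allFin x) (any⁺ _ (lose (∈-allFin y)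
          (Equivalence.from T-∧ (∈⇒T x∈S₁ , Equivalence.from T-∧ (∈⇒T y∈S₂ , fromWitness refl))))))))

    ∈-setOp⁻ : ∀ op {S₁ S₂ : Subset p} {z} → z ∈ setOp p op S₁ S₂ →
               ∃₂ λ x y → x ∈ S₁ × y ∈ S₂ × op x y ≡ z
    ∈-setOp⁻ op {z = z} z∈S₁S₂
      with x , _ , Tx  ← find (any⁻ _ (allFin p) (subst T (lookup∘tabulate _ z) (∈⇒T z∈S₁S₂)))
      with y , _ , Txy ← find (any⁻ _ (allFin p) Tx)
      with Tx∈S₁ , Ty∈S₂∧xy≡z ← Equivalence.to T-∧ Txy
      with Ty∈S₂ , Txy≡z ← Equivalence.to T-∧ Ty∈S₂∧xy≡z
      = x , y , T⇒∈ Tx∈S₁ , T⇒∈ Ty∈S₂ , toWitness Txy≡z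

  ∈-diffSet⁺ : ∀ {S₁ S₂ : Subset p} {u w} → u ∈ S₁ → w ∈ S₂ → u - w ∈ diffSet p S₁ S₂
  ∈-diffSet⁺ {S₁} {S₂} {u} {w} u∈S₁ w∈S₂ =
    subst (_∈ diffSet p S₁ S₂) (-ₚ≡- u w) (∈-setOp⁺ (_-ₚ_ p) u∈S₁ w∈S₂)

  ∈-diffSet⁻ : ∀ {S₁ S₂ : Subset p} {z} → z ∈ diffSet p S₁ S₂ →
               ∃₂ λ u w → u ∈ S₁ × w ∈ S₂ × z ≡ u - w
  ∈-diffSet⁻ z∈S₁-S₂ with u , w , u∈S₁ , w∈S₂ , u-w≡z ← ∈-setOp⁻ (_-ₚ_ p) z∈S₁-S₂ =
    u , w , u∈S₁ , w∈S₂ , trans (sym u-w≡z) (-ₚ≡- u w)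

  ∈-prodSet⁺ : ∀ {S₁ S₂ : Subset p} {x y} → x ∈ S₁ → y ∈ S₂ → x * y ∈ prodSet p S₁ S₂
  ∈-prodSet⁺ = ∈-setOp⁺ (_*ₚ_ p)

  ∈-multSet-suc⁺ : ∀ a {S : Subset p} {u s} → u ∈ multSet p a S → s ∈ S → u + s ∈ multSet p (suc a) S
  ∈-multSet-suc⁺ a = ∈-setOp⁺ (_+ₚ_ p)

  ∈-multSet-suc⁻ : ∀ a {S : Subset p} {z} → z ∈ multSet p (suc a) S →
                   ∃₂ λ u s → u ∈ multSet p a S × s ∈ S × u + s ≡ z
  ∈-multSet-suc⁻ a = ∈-setOp⁻ (_+ₚ_ p)

  ∈-multSet-1 : ∀ {S : Subset p} {s} → s ∈ S → s ∈ multSet p 1 S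
  ∈-multSet-1 {S} {s} s∈S = subst (_∈ multSet p 1 S) (+-identityˡ s) (∈-multSet-suc⁺ 0 (x∈⁅x⁆ 0#) s∈S)

  ∈-powSet-1 : ∀ {A : Subset p} {a} → a ∈ A → a ∈ powSet p A 1
  ∈-powSet-1 {A} {a} a∈A = subst (_∈ powSet p A 1) (*-identityˡ a) (∈-prodSet⁺ (x∈⁅x⁆ 1#) a∈A)

  multSet-+ : ∀ a b {S : Subset p} {u w} → u ∈ multSet p a S → w ∈ multSet p b S →
              u + w ∈ multSet p (a ℕ.+ b) S
  multSet-+ a zero {S} {u} u∈aS w∈0S
    rewrite x∈⁅y⁆⇒x≡y 0# w∈0S | ℕ.+-identityʳ a = subst (_∈ multSet p a S) (sym (+-identityʳ u)) u∈aS
  multSet-+ a (suc b) {S} {u} u∈aS w∈[1+b]S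
    with w′ , s , w′∈bS , s∈S , w′+s≡w ← ∈-multSet-suc⁻ b w∈[1+b]S
    rewrite sym w′+s≡w | ℕ.+-suc a b =
    subst (_∈ multSet p (suc (a ℕ.+ b)) S) (+-assoc u w′ s)
      (∈-multSet-suc⁺ (a ℕ.+ b) (multSet-+ a b u∈aS w′∈bS) s∈S)

  multSet-*ʳ : ∀ a {S Y : Subset p} {u y} → u ∈ multSet p a S → y ∈ Y →
               u * y ∈ multSet p a (prodSet p S Y)
  multSet-*ʳ zero {u = u} {y} u∈0S y∈Y rewrite x∈⁅y⁆⇒x≡y 0# u∈0S =
    subst (_∈ ⁅ 0# ⁆) (sym (zeroˡ y)) (x∈⁅x⁆ 0#)
  multSet-*ʳ (suc a) {S} {Y} {u} {y} u∈[1+a]S y∈Y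
    with u′ , s , u′∈aS , s∈S , u′+s≡u ← ∈-multSet-suc⁻ a u∈[1+a]S
    rewrite sym u′+s≡u =
    subst (_∈ multSet p (suc a) (prodSet p S Y)) (sym (*-distribʳ-+ y u′ s))
      (∈-multSet-suc⁺ a (multSet-*ʳ a u′∈aS y∈Y) (∈-prodSet⁺ s∈S y∈Y))

elements : ∀ {n} → Subset n → List (Fin n)
elements []            = []
elements (inside ∷ S)  = zero ∷ List.map suc (elements S)
elements (outside ∷ S) = List.map suc (elements S)

length-elements : ∀ {n} (S : Subset n) → length (elements S) ≡ ∣ S ∣
length-elements []            = refl
length-elements (inside ∷ S)  = cong suc (trans (List.length-map suc (elements S)) (length-elements S))
length-elements (outside ∷ S) = trans (List.length-map suc (elements S)) (length-elements S)

elements⊆ : ∀ {n} (S : Subset n) → All (_∈ S) (elements S)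
elements⊆ []            = []
elements⊆ (inside ∷ S)  = Vec.here ∷ All.map⁺ (All.map Vec.there (elements⊆ S))
elements⊆ (outside ∷ S) = All.map⁺ (All.map Vec.there (elements⊆ S))

elements-unique : ∀ {n} (S : Subset n) → Unique (elements S)
elements-unique []            = []
elements-unique (inside ∷ S)  =
  All.map⁺ (All.tabulate λ _ ()) ∷ Unique.map⁺ Fin.suc-injective (elements-unique S)
elements-unique (outside ∷ S) = Unique.map⁺ Fin.suc-injective (elements-unique S)

length-cartesianProduct : ∀ {A B : Set} (xs : List A) (ys : List B) →
                          length (List.cartesianProduct xs ys) ≡ length xs ℕ.* length ys
length-cartesianProduct []       ys = refl
length-cartesianProduct (x ∷ xs) ys = begin
  length (List.map (x ,_) ys List.++ List.cartesianProduct xs ys)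
    ≡⟨ List.length-++ (List.map (x ,_) ys) ⟩
  length (List.map (x ,_) ys) ℕ.+ length (List.cartesianProduct xs ys)
    ≡⟨ cong₂ ℕ._+_ (List.length-map (x ,_) ys) (length-cartesianProduct xs ys) ⟩
  length ys ℕ.+ length xs ℕ.* length ys
    ∎
  where open ≡-Reasoning

∃-∈ : ∀ {A : Set} (xs : List A) → 1 ℕ.≤ length xs → ∃ (_∈ₗ xs)
∃-∈ []      ()
∃-∈ (x ∷ _) _ = x , here refl

∃-distinct-∈ : ∀ {A : Set} (xs : List A) → Unique xs → 2 ℕ.≤ length xs →
               ∃₂ λ a b → a ∈ₗ xs × b ∈ₗ xs × a ≢ b
∃-distinct-∈ []          _                 ()
∃-distinct-∈ (_ ∷ [])    _                 (ℕ.s≤s ())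
∃-distinct-∈ (a ∷ b ∷ _) ((a≢b ∷ _) ∷ _) _ = a , b , here refl , there (here refl) , a≢b

module Counting where
  open import Data.Nat using (_+_; _*_; _≤_; z≤n; s≤s)
  open ℕ.≤-Reasoning

  ∃-≤-mean : ∀ {m} .{{_ : NonZero m}} (f : Fin m → ℕ) → ∃ λ i → m * f i ≤ ∑[ j < m ] f j
  ∃-≤-mean {suc zero}    f = zero , ℕ.≤-reflexive refl
  ∃-≤-mean {suc (suc m)} f with i , [1+m]fᵢ≤∑f ← ∃-≤-mean (f ∘ suc) | f zero ℕ.≤? f (suc i)
  ... | yes f₀≤fᵢ = zero , ℕ.+-monoʳ-≤ (f zero) (ℕ.≤-trans (ℕ.*-monoʳ-≤ (suc m) f₀≤fᵢ) [1+m]fᵢ≤∑f)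
  ... | no  f₀≰fᵢ = suc i , ℕ.+-mono-≤ (ℕ.<⇒≤ (ℕ.≰⇒> f₀≰fᵢ)) [1+m]fᵢ≤∑f

  [1+n]C2≡n+nC2 : ∀ n → suc n C 2 ≡ n + n C 2
  [1+n]C2≡n+nC2 n = trans (sym (nCk+nC[k+1]≡[n+1]C[k+1] n 1)) (cong (_+ n C 2) (nC1≡n n))

  2*nC2≤n*n : ∀ n → 2 * (n C 2) ≤ n * n
  2*nC2≤n*n zero    = z≤n
  2*nC2≤n*n (suc n) = begin
    2 * (suc n C 2)        ≡⟨ cong (2 *_) ([1+n]C2≡n+nC2 n) ⟩
    2 * (n + n C 2)        ≡⟨ ℕ.*-distribˡ-+ 2 n (n C 2) ⟩
    2 * n + 2 * (n C 2)    ≤⟨ ℕ.+-monoʳ-≤ (2 * n) (2*nC2≤n*n n) ⟩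
    2 * n + n * n          ≤⟨ ℕ.n≤1+n _ ⟩
    suc (2 * n + n * n)    ≡⟨ square-suc n ⟩
    suc n * suc n          ∎
    where
    square-suc : ∀ n → suc (2 * n + n * n) ≡ suc n * suc n
    square-suc = solve-∀

  𝟙 : ∀ {P : Set} → Dec P → ℕ
  𝟙 (yes _) = 1
  𝟙 (no _)  = 0

  𝟙-sum≡0 : ∀ {m} {P : Fin m → Set} (P? : Decidable P) → (∀ i → ¬ P i) → ∑[ i < m ] 𝟙 (P? i) ≡ 0
  𝟙-sum≡0 {zero}  P? ¬P = refl
  𝟙-sum≡0 {suc m} P? ¬P with P? zero
  ... | yes P0 = contradiction P0 (¬P zero)
  ... | no _   = 𝟙-sum≡0 (P? ∘ suc) (¬P ∘ suc)

  𝟙-sum≤1 : ∀ {m} {P : Fin m → Set} (P? : Decidable P) → (∀ {i j} → P i → P j → i ≡ j) →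
            ∑[ i < m ] 𝟙 (P? i) ≤ 1
  𝟙-sum≤1 {zero}  P? P-unique = z≤n
  𝟙-sum≤1 {suc m} P? P-unique with P? zero
  ... | yes P0 = s≤s (ℕ.≤-reflexive (𝟙-sum≡0 (P? ∘ suc) λ i P[1+i] → 0≢1+n (P-unique P0 P[1+i])))
  ... | no _   = 𝟙-sum≤1 (P? ∘ suc) λ Pi Pj → Fin.suc-injective (P-unique Pi Pj)

  module _ {D : Set} {n : ℕ} where

    matches : (D → Fin n) → D → List D → ℕ
    matches f d []       = 0
    matches f d (e ∷ es) = 𝟙 (f d ≟ f e) + matches f d es

    collisions : (D → Fin n) → List D → ℕ
    collisions f []       = 0
    collisions f (d ∷ ds) = matches f d ds + collisions f ds

    matches≡0⇒≢ : ∀ f d es → matches f d es ≡ 0 → All (λ e → f e ≢ f d) es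
    matches≡0⇒≢ f d []       _   = []
    matches≡0⇒≢ f d (e ∷ es) m≡0 with f d ≟ f e
    ... | no fd≢fe = fd≢fe ∘ sym ∷ matches≡0⇒≢ f d es m≡0

    ≢⇒matches≡0 : ∀ f d es → All (λ e → f d ≢ f e) es → matches f d es ≡ 0
    ≢⇒matches≡0 f d []       []               = refl
    ≢⇒matches≡0 f d (e ∷ es) (fd≢fe ∷ fd≢fes) with f d ≟ f e
    ... | yes fd≡fe = contradiction fd≡fe fd≢fe
    ... | no _      = ≢⇒matches≡0 f d es fd≢fes

    length≤∣S∣+collisions : ∀ f {S : Subset n} ds → All (λ d → f d ∈ S) ds →
                            length ds ≤ ∣ S ∣ + collisions f ds
    length≤∣S∣+collisions f     []       []             = z≤n
    length≤∣S∣+collisions f {S} (d ∷ ds) (fd∈S ∷ fds∈S) with matches f d ds in eq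
    ... | zero  = begin
      suc (length ds)                              ≤⟨ s≤s (length≤∣S∣+collisions f ds fds∈S-fd) ⟩
      suc (∣ S Subset.- f d ∣ + collisions f ds)   ≤⟨ ℕ.+-monoˡ-≤ (collisions f ds) (x∈p⇒∣p-x∣<∣p∣ fd∈S) ⟩
      ∣ S ∣ + collisions f ds                      ∎
      where
      fds∈S-fd : All (λ e → f e ∈ S Subset.- f d) ds
      fds∈S-fd = All.zipWith (uncurry x∈p∧x≢y⇒x∈p-y) (fds∈S , matches≡0⇒≢ f d ds eq)
    ... | suc m = begin
      suc (length ds)                              ≤⟨ s≤s (length≤∣S∣+collisions f ds fds∈S) ⟩
      suc (∣ S ∣ + collisions f ds)                ≡⟨ ℕ.+-suc ∣ S ∣ _ ⟨
      ∣ S ∣ + suc (collisions f ds)                ≤⟨ ℕ.+-monoʳ-≤ ∣ S ∣ (s≤s (ℕ.m≤n+m _ m)) ⟩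
      ∣ S ∣ + (suc m + collisions f ds)            ∎

    matches-mono : ∀ f g → (∀ {d e} → g d ≡ g e → f d ≡ f e) →
                   ∀ d es → matches g d es ≤ matches f d es
    matches-mono f g g⇒f d []       = z≤n
    matches-mono f g g⇒f d (e ∷ es) with g d ≟ g e | f d ≟ f e
    ... | yes gd≡ge | no fd≢fe = contradiction (g⇒f gd≡ge) fd≢fe
    ... | yes _     | yes _    = s≤s (matches-mono f g g⇒f d es)
    ... | no _      | yes _    = ℕ.m≤n⇒m≤1+n (matches-mono f g g⇒f d es)
    ... | no _      | no _     = matches-mono f g g⇒f d es

    collisions-mono : ∀ f g → (∀ {d e} → g d ≡ g e → f d ≡ f e) →
                      ∀ ds → collisions g ds ≤ collisions f ds
    collisions-mono f g g⇒f []       = z≤n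
    collisions-mono f g g⇒f (d ∷ ds) = ℕ.+-mono-≤ (matches-mono f g g⇒f d ds) (collisions-mono f g g⇒f ds)

    collisions≡0 : ∀ f {ds} → Unique ds → (∀ {d e} → d ∈ₗ ds → e ∈ₗ ds → d ≢ e → f d ≢ f e) →
                   collisions f ds ≡ 0
    collisions≡0 f {[]}     []            _     = refl
    collisions≡0 f {d ∷ ds} (d∉ds ∷ ds!) f-inj = cong₂ _+_
      (≢⇒matches≡0 f d ds (All.tabulate λ e∈ds → f-inj (here refl) (there e∈ds) (All.lookup d∉ds e∈ds)))
      (collisions≡0 f ds! λ d∈ds e∈ds → f-inj (there d∈ds) (there e∈ds))

    Separating : ∀ {m} → (Fin m → D → Fin n) → Set
    Separating F = ∀ {d e} → d ≢ e → ∀ {i j} → F i d ≡ F i e → F j d ≡ F j e → i ≡ j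

    ∑-matches≤length : ∀ {m} (F : Fin m → D → Fin n) → Separating F →
                       ∀ d es → All (d ≢_) es → ∑[ i < m ] matches (F i) d es ≤ length es
    ∑-matches≤length {m} F F-sep d []       []           = ℕ.≤-reflexive (sum-replicate-zero m)
    ∑-matches≤length {m} F F-sep d (e ∷ es) (d≢e ∷ d≢es) = begin
      ∑[ i < m ] (𝟙 (F i d ≟ F i e) + matches (F i) d es)
        ≡⟨ ∑-distrib-+ (λ i → 𝟙 (F i d ≟ F i e)) _ ⟩
      ∑[ i < m ] 𝟙 (F i d ≟ F i e) + ∑[ i < m ] matches (F i) d es
        ≤⟨ ℕ.+-mono-≤ (𝟙-sum≤1 (λ i → F i d ≟ F i e) (F-sep d≢e)) (∑-matches≤length F F-sep d es d≢es) ⟩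
      suc (length es)
        ∎

    ∑-collisions≤C2 : ∀ {m} (F : Fin m → D → Fin n) → Separating F →
                      ∀ {ds} → Unique ds → ∑[ i < m ] collisions (F i) ds ≤ length ds C 2
    ∑-collisions≤C2 {m} F F-sep {[]}     []            = ℕ.≤-trans (ℕ.≤-reflexive (sum-replicate-zero m)) z≤n
    ∑-collisions≤C2 {m} F F-sep {d ∷ ds} (d∉ds ∷ ds!) = begin
      ∑[ i < m ] (matches (F i) d ds + collisions (F i) ds)
        ≡⟨ ∑-distrib-+ (λ i → matches (F i) d ds) _ ⟩
      ∑[ i < m ] matches (F i) d ds + ∑[ i < m ] collisions (F i) ds
        ≤⟨ ℕ.+-mono-≤ (∑-matches≤length F F-sep d ds d∉ds) (∑-collisions≤C2 F F-sep ds!) ⟩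
      length ds + length ds C 2
        ≡⟨ [1+n]C2≡n+nC2 (length ds) ⟨
      suc (length ds) C 2
        ∎

    ∃-few-collisions : ∀ {m} .{{_ : NonZero m}} (F : Fin m → D → Fin n) → Separating F →
                       ∀ {ds} → Unique ds → ∃ λ i → m * collisions (F i) ds ≤ length ds C 2
    ∃-few-collisions F F-sep {ds} ds! =
      let i , m*cᵢ≤∑c = ∃-≤-mean (λ i → collisions (F i) ds)
      in  i , ℕ.≤-trans m*cᵢ≤∑c (∑-collisions≤C2 F F-sep ds!)

open Counting

module QuadraticGrowth where
  open import Data.Nat using (_+_; _*_; _≤_; _<_; _≤?_; z≤n; s≤s)
  open ℕ.≤-Reasoning

  -- a ≥ L − L²/(2p), with the denominator cleared
  LowerBound : ℕ → ℕ → ℕ → Set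
  LowerBound p L a = 2 * p * L ≤ 2 * p * a + L * L

  few-collisions⇒LowerBound : ∀ p a c {L} → L ≤ a + c → p * c ≤ L C 2 → LowerBound p L a
  few-collisions⇒LowerBound p a c {L} L≤a+c pc≤LC2 = begin
    2 * p * L                  ≤⟨ ℕ.*-monoʳ-≤ (2 * p) L≤a+c ⟩
    2 * p * (a + c)            ≡⟨ ℕ.*-distribˡ-+ (2 * p) a c ⟩
    2 * p * a + 2 * p * c      ≡⟨ cong (2 * p * a +_) (ℕ.*-assoc 2 p c) ⟩
    2 * p * a + 2 * (p * c)    ≤⟨ ℕ.+-monoʳ-≤ (2 * p * a) (ℕ.*-monoʳ-≤ 2 pc≤LC2) ⟩
    2 * p * a + 2 * (L C 2)    ≤⟨ ℕ.+-monoʳ-≤ (2 * p * a) (2*nC2≤n*n L) ⟩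
    2 * p * a + L * L          ∎

  propagate : ∀ {n X m} p a → 5 ≤ n → m ≤ X → 8 * p * X ≤ 8 * p * m + 5 * (X * X) →
              LowerBound p (m * n) a → 8 * p * (n * X) ≤ 8 * p * a + 5 * ((n * X) * (n * X))
  propagate {n} {X} {m} p a 5≤n m≤X hX hm = ℕ.*-cancelˡ-≤ n {{n≢0}} (begin
    n * (8 * p * N)                              ≡⟨ e₁ n p X ⟩
    (8 * p * X) * (n * n)                        ≤⟨ ℕ.*-monoˡ-≤ (n * n) hX ⟩
    (8 * p * m + 5 * (X * X)) * (n * n)          ≡⟨ e₂ n p X m ⟩
    4 * n * (2 * p * M) + 5 * (N * N)            ≤⟨ ℕ.+-monoˡ-≤ (5 * (N * N)) (ℕ.*-monoʳ-≤ (4 * n) hm) ⟩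
    4 * n * (2 * p * a + M * M) + 5 * (N * N)    ≤⟨ ℕ.+-monoˡ-≤ (5 * (N * N))
                                                      (ℕ.*-monoʳ-≤ (4 * n) (ℕ.+-monoʳ-≤ (2 * p * a) M²≤N²)) ⟩
    4 * n * (2 * p * a + N * N) + 5 * (N * N)    ≤⟨ ℕ.+-monoʳ-≤ _ (ℕ.*-monoˡ-≤ (N * N) 5≤n) ⟩
    4 * n * (2 * p * a + N * N) + n * (N * N)    ≡⟨ e₃ n p a N ⟩
    n * (8 * p * a + 5 * (N * N))                ∎)
    where
    N = n * X
    M = m * n
    n≢0 : NonZero n
    n≢0 = ℕ.>-nonZero (ℕ.≤-trans (s≤s z≤n) 5≤n)
    M≤N : M ≤ N
    M≤N = ℕ.≤-trans (ℕ.*-monoˡ-≤ n m≤X) (ℕ.≤-reflexive (ℕ.*-comm X n))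
    M²≤N² : M * M ≤ N * N
    M²≤N² = ℕ.*-mono-≤ M≤N M≤N
    e₁ : ∀ n p X → n * (8 * p * (n * X)) ≡ (8 * p * X) * (n * n)
    e₁ = solve-∀
    e₂ : ∀ n p X m → (8 * p * m + 5 * (X * X)) * (n * n) ≡ 4 * n * (2 * p * (m * n)) + 5 * ((n * X) * (n * X))
    e₂ = solve-∀
    e₃ : ∀ n p a N → 4 * n * (2 * p * a + N * N) + n * (N * N) ≡ n * (8 * p * a + 5 * (N * N))
    e₃ = solve-∀

  small-regime : ∀ {p X} a → .{{NonZero p}} → X ≤ p → 8 * p * X ≤ 8 * p * a + 5 * (X * X) →
                 3 * X ≤ 8 * a
  small-regime {p} {X} a X≤p hX =
    ℕ.*-cancelˡ-≤ p (ℕ.+-cancelʳ-≤ (5 * (p * X)) (p * (3 * X)) (p * (8 * a)) (begin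
      p * (3 * X) + 5 * (p * X)    ≡⟨ e₁ p X ⟩
      8 * p * X                    ≤⟨ hX ⟩
      8 * p * a + 5 * (X * X)      ≤⟨ ℕ.+-monoʳ-≤ (8 * p * a) (ℕ.*-monoʳ-≤ 5 (ℕ.*-monoˡ-≤ X X≤p)) ⟩
      8 * p * a + 5 * (p * X)      ≡⟨ cong (_+ 5 * (p * X)) (e₂ p a) ⟩
      p * (8 * a) + 5 * (p * X)    ∎))
    where
    e₁ : ∀ p X → p * (3 * X) + 5 * (p * X) ≡ 8 * p * X
    e₁ = solve-∀
    e₂ : ∀ p a → 8 * p * a ≡ p * (8 * a)
    e₂ = solve-∀

  window-regime : ∀ {p M} a → .{{NonZero p}} → p ≤ 4 * M → M ≤ p → LowerBound p M a → 7 * p ≤ 32 * a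
  window-regime {p} {M} a p≤4M M≤p hM =
    ℕ.*-cancelˡ-≤ p (ℕ.+-cancelˡ-≤ (16 * (M * M)) (p * (7 * p)) (p * (32 * a)) (begin
      16 * (M * M) + p * (7 * p)         ≡⟨ e₁ M p ⟩
      (4 * M) * (4 * M) + 7 * (p * p)    ≡⟨ cong (λ z → z * z + 7 * (p * p)) p+r≡4M ⟨
      (p + r) * (p + r) + 7 * (p * p)    ≤⟨ [p+r]²+7p²≤8p[p+r] ⟩
      8 * p * (p + r)                    ≡⟨ cong (8 * p *_) p+r≡4M ⟩
      8 * p * (4 * M)                    ≡⟨ e₂ p M ⟩
      16 * (2 * p * M)                   ≤⟨ ℕ.*-monoʳ-≤ 16 hM ⟩
      16 * (2 * p * a + M * M)           ≡⟨ e₃ p M a ⟩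
      16 * (M * M) + p * (32 * a)        ∎))
    where
    r = 4 * M ∸ p
    p+r≡4M : p + r ≡ 4 * M
    p+r≡4M = ℕ.m+[n∸m]≡n p≤4M
    r≤3p : r ≤ 3 * p
    r≤3p = ℕ.+-cancelˡ-≤ p r (3 * p) (ℕ.≤-trans (ℕ.≤-reflexive p+r≡4M) (ℕ.*-monoʳ-≤ 4 M≤p))
    k₁ : ∀ p r → (p + r) * (p + r) + 7 * (p * p) ≡ 8 * (p * p) + 2 * (p * r) + r * r
    k₁ = solve-∀
    k₂ : ∀ p r → 8 * (p * p) + 2 * (p * r) + 3 * p * r + 3 * p * r ≡ 8 * p * (p + r)
    k₂ = solve-∀
    [p+r]²+7p²≤8p[p+r] : (p + r) * (p + r) + 7 * (p * p) ≤ 8 * p * (p + r)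
    [p+r]²+7p²≤8p[p+r] = begin
      (p + r) * (p + r) + 7 * (p * p)                      ≡⟨ k₁ p r ⟩
      8 * (p * p) + 2 * (p * r) + r * r                    ≤⟨ ℕ.+-monoʳ-≤ _ (ℕ.*-monoˡ-≤ r r≤3p) ⟩
      8 * (p * p) + 2 * (p * r) + 3 * p * r                ≤⟨ ℕ.m≤m+n _ (3 * p * r) ⟩
      8 * (p * p) + 2 * (p * r) + 3 * p * r + 3 * p * r    ≡⟨ k₂ p r ⟩
      8 * p * (p + r)                                      ∎
    e₁ : ∀ M p → 16 * (M * M) + p * (7 * p) ≡ (4 * M) * (4 * M) + 7 * (p * p)
    e₁ = solve-∀
    e₂ : ∀ p M → 8 * p * (4 * M) ≡ 16 * (2 * p * M)
    e₂ = solve-∀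
    e₃ : ∀ p M a → 16 * (2 * p * a + M * M) ≡ 16 * (M * M) + p * (32 * a)
    e₃ = solve-∀

  ∃-window : ∀ {n p} .{{_ : NonZero p}} a → n ≤ p → p ≤ 4 * a * n →
             ∃ λ m → m ≤ a × p ≤ 4 * (m * n) × m * n ≤ p
  ∃-window {n} {p} zero    n≤p p≤0 = contradiction p≤0 (ℕ.<⇒≱ (ℕ.>-nonZero⁻¹ p))
  ∃-window {n} {p} (suc a) n≤p p≤4[1+a]n with suc a * n ≤? p
  ... | yes [1+a]n≤p = suc a , ℕ.≤-refl , ℕ.≤-trans p≤4[1+a]n (ℕ.≤-reflexive (ℕ.*-assoc 4 (suc a) n)) , [1+a]n≤p
  ... | no  [1+a]n≰p with a
  ...   | zero   = contradiction (subst (_≤ p) (sym (ℕ.+-identityʳ n)) n≤p) [1+a]n≰p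
  ...   | suc a′ =
    let m , m≤1+a′ , p≤4mn , mn≤p = ∃-window (suc a′) n≤p p≤4[1+a′]n
    in  m , ℕ.m≤n⇒m≤1+n m≤1+a′ , p≤4mn , mn≤p
    where
    2+a≤4[1+a] : ∀ a → 2 + a ≤ 4 * suc a
    2+a≤4[1+a] a = ℕ.≤-trans (ℕ.m≤m+n (2 + a) (2 + 3 * a)) (ℕ.≤-reflexive (e a))
      where
      e : ∀ a → 2 + a + (2 + 3 * a) ≡ 4 * suc a
      e = solve-∀
    p≤4[1+a′]n : p ≤ 4 * suc a′ * n
    p≤4[1+a′]n = ℕ.≤-trans (ℕ.<⇒≤ (ℕ.≰⇒> [1+a]n≰p)) (ℕ.*-monoˡ-≤ n (2+a≤4[1+a] a′))

  module Growth {n p : ℕ} .{{_ : NonZero p}} (a : ℕ → ℕ) (5≤n : 5 ≤ n) (n≤p : n ≤ p) (a₁≡n : a 1 ≡ n)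
    (step : ∀ k → 1 ≤ k → ∀ m → m ≤ a k → LowerBound p (m * n) (a (suc k))) where

    Invariant : ℕ → Set
    Invariant k = 8 * p * n ^ k ≤ 8 * p * a k + 5 * (n ^ k * n ^ k)

    invariant-step : ∀ k → Invariant (suc k) → Invariant (suc (suc k))
    invariant-step k ih =
      propagate p (a (suc (suc k))) 5≤n (ℕ.m⊓n≤n (a (suc k)) X) clipped
                (step (suc k) (s≤s z≤n) m (ℕ.m⊓n≤m (a (suc k)) X))
      where
      X = n ^ suc k
      m = a (suc k) ⊓ X
      clipped : 8 * p * X ≤ 8 * p * m + 5 * (X * X)
      clipped with ℕ.≤-total (a (suc k)) X
      ... | inj₁ a≤X = subst (λ z → 8 * p * X ≤ 8 * p * z + 5 * (X * X)) (sym (ℕ.m≤n⇒m⊓n≡m a≤X)) ih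
      ... | inj₂ X≤a = subst (λ z → 8 * p * X ≤ 8 * p * z + 5 * (X * X)) (sym (ℕ.m≥n⇒m⊓n≡n X≤a))
                             (ℕ.m≤m+n _ _)

    invariant : ∀ k → 1 ≤ k → Invariant k
    invariant (suc zero)    _ = begin
      8 * p * (n * 1)                         ≡⟨ cong (8 * p *_) (ℕ.*-identityʳ n) ⟩
      8 * p * n                               ≡⟨ cong (8 * p *_) a₁≡n ⟨
      8 * p * a 1                             ≤⟨ ℕ.m≤m+n _ _ ⟩
      8 * p * a 1 + 5 * (n * 1 * (n * 1))     ∎
    invariant (suc (suc k)) _ = invariant-step k (invariant (suc k) (s≤s z≤n))

    small : ∀ k → 1 ≤ k → n ^ k ≤ p → 3 * n ^ k ≤ 8 * a k
    small k 1≤k nᵏ≤p = small-regime (a k) nᵏ≤p (invariant k 1≤k)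

    large-step : ∀ k → (p < n ^ suc k → 7 * p ≤ 32 * a (suc k)) →
                 p < n ^ suc (suc k) → 7 * p ≤ 32 * a (suc (suc k))
    large-step k ih p<nᵏ⁺² =
      let m , m≤a , p≤4mn , mn≤p = ∃-window (a (suc k)) n≤p p≤4an
      in  window-regime (a (suc (suc k))) p≤4mn mn≤p (step (suc k) (s≤s z≤n) m m≤a)
      where
      e₁ : ∀ n X → 3 * (n * X) ≡ n * (3 * X)
      e₁ = solve-∀
      e₂ : ∀ n a → n * (8 * a) ≡ 2 * (4 * a * n)
      e₂ = solve-∀
      e₃ : ∀ n a → 28 * n * a ≡ 7 * (4 * a * n)
      e₃ = solve-∀
      p≤4an : p ≤ 4 * a (suc k) * n
      p≤4an with n ^ suc k ≤? p
      ... | yes nᵏ⁺¹≤p = ℕ.*-cancelˡ-≤ 2 (begin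
        2 * p                      ≤⟨ ℕ.*-monoˡ-≤ p (ℕ.n≤1+n 2) ⟩
        3 * p                      ≤⟨ ℕ.*-monoʳ-≤ 3 (ℕ.<⇒≤ p<nᵏ⁺²) ⟩
        3 * (n * n ^ suc k)        ≡⟨ e₁ n (n ^ suc k) ⟩
        n * (3 * n ^ suc k)        ≤⟨ ℕ.*-monoʳ-≤ n (small (suc k) (s≤s z≤n) nᵏ⁺¹≤p) ⟩
        n * (8 * a (suc k))        ≡⟨ e₂ n (a (suc k)) ⟩
        2 * (4 * a (suc k) * n)    ∎)
      ... | no  nᵏ⁺¹≰p = ℕ.*-cancelˡ-≤ 7 (begin
        7 * p                      ≤⟨ ih (ℕ.≰⇒> nᵏ⁺¹≰p) ⟩
        32 * a (suc k)             ≤⟨ ℕ.*-monoˡ-≤ (a (suc k)) (ℕ.≤-trans (ℕ.m≤m+n 32 108) (ℕ.*-monoʳ-≤ 28 5≤n)) ⟩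
        28 * n * a (suc k)         ≡⟨ e₃ n (a (suc k)) ⟩
        7 * (4 * a (suc k) * n)    ∎)

    large : ∀ k → 1 ≤ k → p < n ^ k → 7 * p ≤ 32 * a k
    large (suc zero)    _ p<n = contradiction (subst (_≤ p) (sym (ℕ.*-identityʳ n)) n≤p) (ℕ.<⇒≱ p<n)
    large (suc (suc k)) _     = large-step k (large (suc k) (s≤s z≤n))

    bound : ∀ k → 1 ≤ k → 3 * ((2 * n ^ k) ⊓ (p ∸ 1)) ≤ 16 * a k
    bound k 1≤k with n ^ k ≤? p
    ... | yes nᵏ≤p = begin
      3 * ((2 * n ^ k) ⊓ (p ∸ 1))    ≤⟨ ℕ.*-monoʳ-≤ 3 (ℕ.m⊓n≤m (2 * n ^ k) (p ∸ 1)) ⟩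
      3 * (2 * n ^ k)                ≡⟨ e₁ (n ^ k) ⟩
      2 * (3 * n ^ k)                ≤⟨ ℕ.*-monoʳ-≤ 2 (small k 1≤k nᵏ≤p) ⟩
      2 * (8 * a k)                  ≡⟨ e₂ (a k) ⟩
      16 * a k                       ∎
      where
      e₁ : ∀ X → 3 * (2 * X) ≡ 2 * (3 * X)
      e₁ = solve-∀
      e₂ : ∀ a → 2 * (8 * a) ≡ 16 * a
      e₂ = solve-∀
    ... | no nᵏ≰p = ℕ.*-cancelˡ-≤ 2 (begin
      2 * (3 * ((2 * n ^ k) ⊓ (p ∸ 1)))    ≤⟨ ℕ.*-monoʳ-≤ 2 (ℕ.*-monoʳ-≤ 3 min≤p) ⟩
      2 * (3 * p)                          ≡⟨ e₁ p ⟩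
      6 * p                                ≤⟨ ℕ.*-monoˡ-≤ p (ℕ.n≤1+n 6) ⟩
      7 * p                                ≤⟨ large k 1≤k (ℕ.≰⇒> nᵏ≰p) ⟩
      32 * a k                             ≡⟨ e₂ (a k) ⟩
      2 * (16 * a k)                       ∎)
      where
      min≤p : (2 * n ^ k) ⊓ (p ∸ 1) ≤ p
      min≤p = ℕ.≤-trans (ℕ.m⊓n≤n (2 * n ^ k) (p ∸ 1)) (ℕ.m∸n≤m p 1)
      e₁ : ∀ p → 2 * (3 * p) ≡ 6 * p
      e₁ = solve-∀
      e₂ : ∀ a → 32 * a ≡ 2 * (16 * a)
      e₂ = solve-∀

open QuadraticGrowth

module Projections (p : ℕ) .{{_ : NonZero p}} (prime : Prime p) where
  open PrimeField p prime
  open ≡-Reasoning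

  projection : Fin p → Fin p × Fin p → Fin p
  projection ξ (x , y) = x + ξ * y

  collision⇒slope : ∀ ξ x y x′ y′ → projection ξ (x , y) ≡ projection ξ (x′ , y′) → ξ * (y - y′) ≡ x′ - x
  collision⇒slope ξ x y x′ y′ eq = begin
    ξ * (y - y′)                ≡⟨ solve 4 (λ ξ x y y′ → ξ :* (y :- y′) := x :+ ξ :* y :- x :- ξ :* y′)
                                           refl ξ x y y′ ⟩
    x + ξ * y - x - ξ * y′      ≡⟨ cong (λ z → z - x - ξ * y′) eq ⟩
    x′ + ξ * y′ - x - ξ * y′    ≡⟨ solve 4 (λ ξ x x′ y′ → x′ :+ ξ :* y′ :- x :- ξ :* y′ := x′ :- x)
                                           refl ξ x x′ y′ ⟩
    x′ - x                      ∎

  collision⇒y≢y′ : ∀ ξ x y x′ y′ → (x , y) ≢ (x′ , y′) →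
                   projection ξ (x , y) ≡ projection ξ (x′ , y′) → y ≢ y′
  collision⇒y≢y′ ξ x y x′ .y d≢e eq refl = d≢e (cong (_, y) (sym (x-y≡0⇒x≡y (begin
    x′ - x        ≡⟨ collision⇒slope ξ x y x′ y eq ⟨
    ξ * (y - y)   ≡⟨ solve 2 (λ ξ y → ξ :* (y :- y) := con (ℤ.+ 0)) refl ξ y ⟩
    0#            ∎))))

  projections-separate : Separating projection
  projections-separate {x , y} {x′ , y′} d≢e {ξ} {ξ′} eq eq′ =
    *-cancelˡ (x≢y⇒x-y≢0 (collision⇒y≢y′ ξ x y x′ y′ d≢e eq)) (begin
      (y - y′) * ξ     ≡⟨ *-comm (y - y′) ξ ⟩
      ξ * (y - y′)     ≡⟨ collision⇒slope ξ x y x′ y′ eq ⟩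
      x′ - x           ≡⟨ collision⇒slope ξ′ x y x′ y′ eq′ ⟨
      ξ′ * (y - y′)    ≡⟨ *-comm ξ′ (y - y′) ⟩
      (y - y′) * ξ′    ∎)

  Collides : List (Fin p × Fin p) → Fin p → Set
  Collides ds ξ = Any (λ d → Any (λ e → d ≢ e × projection ξ d ≡ projection ξ e) ds) ds

  collides? : ∀ ds → Decidable (Collides ds)
  collides? ds ξ =
    any? (λ d → any? (λ e → ¬? (≡-dec _≟_ _≟_ d e) ×-dec (projection ξ d ≟ projection ξ e)) ds) ds

  ¬collides⇒collisions≡0 : ∀ {ds} → Unique ds → ∀ ξ → ¬ Collides ds ξ → collisions (projection ξ) ds ≡ 0
  ¬collides⇒collisions≡0 ds! ξ ¬col =
    collisions≡0 (projection ξ) ds! λ d∈ds e∈ds d≢e eq → ¬col (lose d∈ds (lose e∈ds (d≢e , eq)))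

  module _ {ds : List (Fin p × Fin p)} (ds! : Unique ds) {T : Subset p} {t : Fin p} (t≢0 : t ≢ 0#)
    (dilates∈T : ∀ ξ {d e f} → d ∈ₗ ds → e ∈ₗ ds → projection ξ d ≡ projection ξ e → f ∈ₗ ds →
                 (proj₂ d - proj₂ e) * projection ξ f ∈ T × (proj₂ d - proj₂ e) * projection (ξ + t) f ∈ T)
    where

    length≤∣T∣+collisions : ∀ ξ → Collides ds ξ →
                            length ds ℕ.≤ ∣ T ∣ ℕ.+ collisions (projection ξ) ds ×
                            length ds ℕ.≤ ∣ T ∣ ℕ.+ collisions (projection (ξ + t)) ds
    length≤∣T∣+collisions ξ col
      with d@(x , y) , d∈ds , col-d ← find col
      with e@(x′ , y′) , e∈ds , d≢e , eq ← find col-d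
      = bound ξ (proj₁ ∘ dilates) , bound (ξ + t) (proj₂ ∘ dilates)
      where
      dilates : ∀ {f} → f ∈ₗ ds → (y - y′) * projection ξ f ∈ T × (y - y′) * projection (ξ + t) f ∈ T
      dilates = dilates∈T ξ d∈ds e∈ds eq

      y-y′≢0 : y - y′ ≢ 0#
      y-y′≢0 = x≢y⇒x-y≢0 (collision⇒y≢y′ ξ x y x′ y′ d≢e eq)

      bound : ∀ ζ → (∀ {f} → f ∈ₗ ds → (y - y′) * projection ζ f ∈ T) →
              length ds ℕ.≤ ∣ T ∣ ℕ.+ collisions (projection ζ) ds
      bound ζ dilate∈T = ℕ.≤-trans
        (length≤∣S∣+collisions (λ f → (y - y′) * projection ζ f) ds (All.tabulate dilate∈T))
        (ℕ.+-monoʳ-≤ ∣ T ∣ (collisions-mono (projection ζ) _ (*-cancelˡ y-y′≢0) ds))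

    projection-bound : Collides ds 0# → LowerBound p (length ds) ∣ T ∣
    projection-bound col₀ = below-average (∃-few-collisions projection projections-separate ds!)
      where
      across-boundary : (∃ λ η → Collides ds η × ¬ Collides ds (η + t)) → LowerBound p (length ds) ∣ T ∣
      across-boundary (η , colη , ¬colη+t) =
        few-collisions⇒LowerBound p ∣ T ∣ 0
          (subst (λ c → length ds ℕ.≤ ∣ T ∣ ℕ.+ c) (¬collides⇒collisions≡0 ds! (η + t) ¬colη+t)
                 (proj₂ (length≤∣T∣+collisions η colη)))
          (ℕ.≤-trans (ℕ.≤-reflexive (ℕ.*-zeroʳ p)) ℕ.z≤n)

      below-average : (∃ λ ξ → p ℕ.* collisions (projection ξ) ds ℕ.≤ length ds C 2) →
                      LowerBound p (length ds) ∣ T ∣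
      below-average (ξ , few) with collides? ds ξ
      ... | yes col = few-collisions⇒LowerBound p ∣ T ∣ (collisions (projection ξ) ds)
                        (proj₁ (length≤∣T∣+collisions ξ col)) few
      ... | no ¬col = across-boundary (∃-boundary (collides? ds) t≢0 col₀ ξ ¬col)

module DifferenceSets (p : ℕ) .{{_ : NonZero p}} (prime : Prime p) {S Y : Subset p} (N₁ N₂ : ℕ) where
  open PrimeField p prime
  open SetArithmetic p
  open Projections p prime
  open ≡-Reasoning

  -- One more summand than the four coming from a dilate of u − w: it holds the t·y₁·y or t·y₂·y
  -- contributed by the step from ξ to ξ + t.
  N : ℕ
  N = N₁ ℕ.+ N₂ ℕ.+ N₁ ℕ.+ N₂ ℕ.+ 1

  D : Subset p
  D = diffSet p (multSet p N (prodSet p S Y)) (multSet p N (prodSet p S Y))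

  IsDifference : Fin p → Set
  IsDifference x = ∃₂ λ u w → u ∈ multSet p N₁ S × w ∈ multSet p N₂ S × x ≡ u - w

  sum∈N[SY] : ∀ {u w u′ w′ s a b y} →
    u ∈ multSet p N₁ S → w ∈ multSet p N₂ S → u′ ∈ multSet p N₁ S → w′ ∈ multSet p N₂ S → s ∈ S →
    a ∈ Y → b ∈ Y → y ∈ Y → u * a + w * b + u′ * y + w′ * y + s * y ∈ multSet p N (prodSet p S Y)
  sum∈N[SY] u∈ w∈ u′∈ w′∈ s∈S a∈Y b∈Y y∈Y =
    multSet-+ (N₁ ℕ.+ N₂ ℕ.+ N₁ ℕ.+ N₂) 1
      (multSet-+ (N₁ ℕ.+ N₂ ℕ.+ N₁) N₂
        (multSet-+ (N₁ ℕ.+ N₂) N₁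
          (multSet-+ N₁ N₂ (multSet-*ʳ N₁ u∈ a∈Y) (multSet-*ʳ N₂ w∈ b∈Y))
          (multSet-*ʳ N₁ u′∈ y∈Y))
        (multSet-*ʳ N₂ w′∈ y∈Y))
      (∈-multSet-1 (∈-prodSet⁺ s∈S y∈Y))

  dilate-ξ : ∀ ξ t y₁ y₂ y u w u₁ w₁ u₂ w₂ → ξ * (y₁ - y₂) ≡ (u₂ - w₂) - (u₁ - w₁) →
    (y₁ - y₂) * projection ξ (u - w , y) ≡
    (u * y₁ + w * y₂ + u₂ * y + w₁ * y + t * y₁ * y) - (u * y₂ + w * y₁ + u₁ * y + w₂ * y + t * y₁ * y)
  dilate-ξ ξ t y₁ y₂ y u w u₁ w₁ u₂ w₂ slope = begin
    (y₁ - y₂) * (u - w + ξ * y)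
      ≡⟨ solve 5 (λ y₁ y₂ x ξ y → (y₁ :- y₂) :* (x :+ ξ :* y) := (y₁ :- y₂) :* x :+ ξ :* (y₁ :- y₂) :* y)
                 refl y₁ y₂ (u - w) ξ y ⟩
    (y₁ - y₂) * (u - w) + ξ * (y₁ - y₂) * y
      ≡⟨ cong (λ z → (y₁ - y₂) * (u - w) + z * y) slope ⟩
    (y₁ - y₂) * (u - w) + ((u₂ - w₂) - (u₁ - w₁)) * y
      ≡⟨ solve 10 (λ y₁ y₂ y u w u₁ w₁ u₂ w₂ t →
           (y₁ :- y₂) :* (u :- w) :+ ((u₂ :- w₂) :- (u₁ :- w₁)) :* y
           := (u :* y₁ :+ w :* y₂ :+ u₂ :* y :+ w₁ :* y :+ t :* y₁ :* y)
              :- (u :* y₂ :+ w :* y₁ :+ u₁ :* y :+ w₂ :* y :+ t :* y₁ :* y))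
           refl y₁ y₂ y u w u₁ w₁ u₂ w₂ t ⟩
    (u * y₁ + w * y₂ + u₂ * y + w₁ * y + t * y₁ * y) - (u * y₂ + w * y₁ + u₁ * y + w₂ * y + t * y₁ * y)
      ∎

  dilate-ξ+t : ∀ ξ t y₁ y₂ y u w u₁ w₁ u₂ w₂ → ξ * (y₁ - y₂) ≡ (u₂ - w₂) - (u₁ - w₁) →
    (y₁ - y₂) * projection (ξ + t) (u - w , y) ≡
    (u * y₁ + w * y₂ + u₂ * y + w₁ * y + t * y₁ * y) - (u * y₂ + w * y₁ + u₁ * y + w₂ * y + t * y₂ * y)
  dilate-ξ+t ξ t y₁ y₂ y u w u₁ w₁ u₂ w₂ slope = begin
    (y₁ - y₂) * (u - w + (ξ + t) * y)
      ≡⟨ solve 6 (λ y₁ y₂ x ξ y t →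
           (y₁ :- y₂) :* (x :+ (ξ :+ t) :* y) := (y₁ :- y₂) :* x :+ ξ :* (y₁ :- y₂) :* y :+ t :* (y₁ :- y₂) :* y)
           refl y₁ y₂ (u - w) ξ y t ⟩
    (y₁ - y₂) * (u - w) + ξ * (y₁ - y₂) * y + t * (y₁ - y₂) * y
      ≡⟨ cong (λ z → (y₁ - y₂) * (u - w) + z * y + t * (y₁ - y₂) * y) slope ⟩
    (y₁ - y₂) * (u - w) + ((u₂ - w₂) - (u₁ - w₁)) * y + t * (y₁ - y₂) * y
      ≡⟨ solve 10 (λ y₁ y₂ y u w u₁ w₁ u₂ w₂ t →
           (y₁ :- y₂) :* (u :- w) :+ ((u₂ :- w₂) :- (u₁ :- w₁)) :* y :+ t :* (y₁ :- y₂) :* y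
           := (u :* y₁ :+ w :* y₂ :+ u₂ :* y :+ w₁ :* y :+ t :* y₁ :* y)
              :- (u :* y₂ :+ w :* y₁ :+ u₁ :* y :+ w₂ :* y :+ t :* y₂ :* y))
           refl y₁ y₂ y u w u₁ w₁ u₂ w₂ t ⟩
    (u * y₁ + w * y₂ + u₂ * y + w₁ * y + t * y₁ * y) - (u * y₂ + w * y₁ + u₁ * y + w₂ * y + t * y₂ * y)
      ∎

  module _ {t : Fin p} (tY⊆S : ∀ {y} → y ∈ Y → t * y ∈ S) where

    dilates∈D : ∀ ξ {x₁ y₁ x₂ y₂ x y} → IsDifference x₁ → IsDifference x₂ → IsDifference x →
                y₁ ∈ Y → y₂ ∈ Y → y ∈ Y → projection ξ (x₁ , y₁) ≡ projection ξ (x₂ , y₂) →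
                (y₁ - y₂) * projection ξ (x , y) ∈ D × (y₁ - y₂) * projection (ξ + t) (x , y) ∈ D
    dilates∈D ξ {y₁ = y₁} {y₂ = y₂} {y = y}
      (u₁ , w₁ , u₁∈ , w₁∈ , refl) (u₂ , w₂ , u₂∈ , w₂∈ , refl) (u , w , u∈ , w∈ , refl)
      y₁∈Y y₂∈Y y∈Y eq =
        subst (_∈ D) (sym (dilate-ξ ξ t y₁ y₂ y u w u₁ w₁ u₂ w₂ slope))
          (∈-diffSet⁺ (sum∈N[SY] u∈ w∈ u₂∈ w₁∈ (tY⊆S y₁∈Y) y₁∈Y y₂∈Y y∈Y)
                      (sum∈N[SY] u∈ w∈ u₁∈ w₂∈ (tY⊆S y₁∈Y) y₂∈Y y₁∈Y y∈Y))
      , subst (_∈ D) (sym (dilate-ξ+t ξ t y₁ y₂ y u w u₁ w₁ u₂ w₂ slope))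
          (∈-diffSet⁺ (sum∈N[SY] u∈ w∈ u₂∈ w₁∈ (tY⊆S y₁∈Y) y₁∈Y y₂∈Y y∈Y)
                      (sum∈N[SY] u∈ w∈ u₁∈ w₂∈ (tY⊆S y₂∈Y) y₂∈Y y₁∈Y y∈Y))
      where
      slope : ξ * (y₁ - y₂) ≡ (u₂ - w₂) - (u₁ - w₁)
      slope = collision⇒slope ξ (u₁ - w₁) y₁ (u₂ - w₂) y₂ eq

    difference-bound : ∀ {X : Subset p} → (∀ {x} → x ∈ X → IsDifference x) → t ≢ 0# → 2 ℕ.≤ ∣ Y ∣ →
                       ∀ m → m ℕ.≤ ∣ X ∣ → LowerBound p (m ℕ.* ∣ Y ∣) ∣ D ∣
    difference-bound X⊆ t≢0 2≤∣Y∣ zero    _ = ℕ.≤-trans (ℕ.≤-reflexive (ℕ.*-zeroʳ (2 ℕ.* p))) ℕ.z≤n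
    difference-bound {X} X⊆ t≢0 2≤∣Y∣ (suc m) 1+m≤∣X∣ =
      subst (λ L → LowerBound p L ∣ D ∣) length-ds (projection-bound ds! t≢0 dilates collides-at-0)
      where
      xs = List.take (suc m) (elements X)
      ys = elements Y
      ds = List.cartesianProduct xs ys

      length-xs : length xs ≡ suc m
      length-xs = trans (List.length-take (suc m) (elements X))
                        (ℕ.m≤n⇒m⊓n≡m (subst (suc m ℕ.≤_) (sym (length-elements X)) 1+m≤∣X∣))

      length-ds : length ds ≡ suc m ℕ.* ∣ Y ∣
      length-ds = trans (length-cartesianProduct xs ys) (cong₂ ℕ._*_ length-xs (length-elements Y))

      ds! : Unique ds
      ds! = Unique.cartesianProduct⁺ (Unique.take⁺ (suc m) (elements-unique X)) (elements-unique Y)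

      ∈X×Y : ∀ {x y} → (x , y) ∈ₗ ds → IsDifference x × y ∈ Y
      ∈X×Y xy∈ds with x∈xs , y∈ys ← ∈-cartesianProduct⁻ xs ys xy∈ds =
        X⊆ (All.lookup (All.take⁺ (suc m) (elements⊆ X)) x∈xs) , All.lookup (elements⊆ Y) y∈ys

      dilates : ∀ ξ {d e f} → d ∈ₗ ds → e ∈ₗ ds → projection ξ d ≡ projection ξ e → f ∈ₗ ds →
                (proj₂ d - proj₂ e) * projection ξ f ∈ D × (proj₂ d - proj₂ e) * projection (ξ + t) f ∈ D
      dilates ξ {_ , _} {_ , _} {_ , _} d∈ds e∈ds eq f∈ds
        with x₁∈ , y₁∈ ← ∈X×Y d∈ds | x₂∈ , y₂∈ ← ∈X×Y e∈ds | x∈ , y∈ ← ∈X×Y f∈ds =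
        dilates∈D ξ x₁∈ x₂∈ x∈ y₁∈ y₂∈ y∈ eq

      collides-at-0 : Collides ds 0#
      collides-at-0
        with x , x∈xs ← ∃-∈ xs (subst (1 ℕ.≤_) (sym length-xs) (ℕ.s≤s ℕ.z≤n))
           | a , b , a∈ys , b∈ys , a≢b ← ∃-distinct-∈ ys (elements-unique Y)
                                           (subst (2 ℕ.≤_) (sym (length-elements Y)) 2≤∣Y∣) =
        lose (∈-cartesianProduct⁺ x∈xs a∈ys) (lose (∈-cartesianProduct⁺ x∈xs b∈ys)
          (a≢b ∘ cong proj₂ , cong (x +_) (trans (zeroˡ a) (sym (zeroˡ b)))))

module NkRecurrence where
  open import Data.Nat using (_+_; _*_)
  open ≡-Reasoning

  5*4^k≡Nk*24+8 : ∀ i → 5 * 4 ^ (2 + i) ≡ Nk (2 + i) * 24 + 8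
  Nk-suc : ∀ i → Nk (3 + i) ≡ 4 * Nk (2 + i) + 1

  5*4^[1+k]≡[4Nk+1]*24+8 : ∀ i → 5 * 4 ^ (3 + i) ≡ (4 * Nk (2 + i) + 1) * 24 + 8
  5*4^[1+k]≡[4Nk+1]*24+8 i = begin
    5 * (4 * 4 ^ (2 + i))            ≡⟨ e₁ (4 ^ (2 + i)) ⟩
    4 * (5 * 4 ^ (2 + i))            ≡⟨ cong (4 *_) (5*4^k≡Nk*24+8 i) ⟩
    4 * (Nk (2 + i) * 24 + 8)        ≡⟨ e₂ (Nk (2 + i)) ⟩
    (4 * Nk (2 + i) + 1) * 24 + 8    ∎
    where
    e₁ : ∀ X → 5 * (4 * X) ≡ 4 * (5 * X)
    e₁ = solve-∀
    e₂ : ∀ N → 4 * (N * 24 + 8) ≡ (4 * N + 1) * 24 + 8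
    e₂ = solve-∀

  5*4^k≡Nk*24+8 zero    = refl
  5*4^k≡Nk*24+8 (suc i) = trans (5*4^[1+k]≡[4Nk+1]*24+8 i) (cong (λ N → N * 24 + 8) (sym (Nk-suc i)))

  Nk-suc i = begin
    (5 * 4 ^ (3 + i) ∸ 8) / 24                  ≡⟨ cong (λ z → (z ∸ 8) / 24) (5*4^[1+k]≡[4Nk+1]*24+8 i) ⟩
    ((4 * Nk (2 + i) + 1) * 24 + 8 ∸ 8) / 24    ≡⟨ cong (_/ 24) (ℕ.m+n∸n≡m ((4 * Nk (2 + i) + 1) * 24) 8) ⟩
    (4 * Nk (2 + i) + 1) * 24 / 24              ≡⟨ m*n/n≡m (4 * Nk (2 + i) + 1) 24 ⟩
    4 * Nk (2 + i) + 1                          ∎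

  4Nk+1≡Nk[1+k] : ∀ i → Nk (2 + i) + Nk (2 + i) + Nk (2 + i) + Nk (2 + i) + 1 ≡ Nk (3 + i)
  4Nk+1≡Nk[1+k] i = trans (e (Nk (2 + i))) (sym (Nk-suc i))
    where
    e : ∀ N → N + N + N + N + 1 ≡ 4 * N + 1
    e = solve-∀

module Iteration (p : ℕ) .{{_ : NonZero p}} (prime : Prime p) (A : Subset p) (2≤∣A∣ : 2 ℕ.≤ ∣ A ∣) where
  open PrimeField p prime
  open SetArithmetic p

  ∃-nonzero-∈ : ∃ λ a → a ∈ A × a ≢ 0#
  ∃-nonzero-∈
    with a , b , a∈A , b∈A , a≢b ← ∃-distinct-∈ (elements A) (elements-unique A)
                                     (subst (2 ℕ.≤_) (sym (length-elements A)) 2≤∣A∣)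
    with a ≟ 0#
  ... | yes refl = b , All.lookup (elements⊆ A) b∈A , a≢b ∘ sym
  ... | no  a≢0  = a , All.lookup (elements⊆ A) a∈A , a≢0

  ∃-nonzero-powSet : ∀ j → ∃ λ t → t ∈ powSet p A j × t ≢ 0#
  ∃-nonzero-powSet zero    = 1# , x∈⁅x⁆ 1# , 1#≢0#
  ∃-nonzero-powSet (suc j) =
    let t , t∈Aʲ , t≢0 = ∃-nonzero-powSet j
        a , a∈A  , a≢0 = ∃-nonzero-∈
    in  t * a , ∈-prodSet⁺ t∈Aʲ a∈A , *-≢0 t≢0 a≢0

  Aseq-step : ∀ k → 1 ℕ.≤ k → ∀ m → m ℕ.≤ ∣ Aseq p A k ∣ → LowerBound p (m ℕ.* ∣ A ∣) ∣ Aseq p A (suc k) ∣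
  Aseq-step (suc zero) _ =
    difference-bound (∈-prodSet⁺ (x∈⁅x⁆ 1#)) {X = A}
      (λ {x} x∈A → x , 0# , ∈-multSet-1 (∈-powSet-1 x∈A) , x∈⁅x⁆ 0# , x≡x-0# x) 1#≢0# 2≤∣A∣
    where
    open DifferenceSets p prime {S = powSet p A 1} {Y = A} 1 0
    x≡x-0# : ∀ x → x ≡ x - 0#
    x≡x-0# = solve 1 (λ x → x := x :- con (ℤ.+ 0)) refl
  Aseq-step (suc (suc i)) _ =
    let t , t∈Aⁱ⁺¹ , t≢0 = ∃-nonzero-powSet (suc i)
    in  subst (λ N → ∀ m → m ℕ.≤ ∣ Aseq p A (2 ℕ.+ i) ∣ → LowerBound p (m ℕ.* ∣ A ∣) ∣ N[Aⁱ⁺³]-N[Aⁱ⁺³] N ∣)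
              (NkRecurrence.4Nk+1≡Nk[1+k] i)
              (DifferenceSets.difference-bound p prime {S = powSet p A (2 ℕ.+ i)} {Y = A}
                 (Nk (2 ℕ.+ i)) (Nk (2 ℕ.+ i)) (∈-prodSet⁺ t∈Aⁱ⁺¹) ∈-diffSet⁻ t≢0 2≤∣A∣)
    where
    N[Aⁱ⁺³]-N[Aⁱ⁺³] : ℕ → Subset p
    N[Aⁱ⁺³]-N[Aⁱ⁺³] N = diffSet p (multSet p N (powSet p A (3 ℕ.+ i))) (multSet p N (powSet p A (3 ℕ.+ i)))

open import Data.Nat using (_*_; _≤_; _<_)

lemma9 : (p : ℕ) .{{_ : NonZero p}} → Prime p → 2 < p →
    (A : Subset p) → 5 ≤ ∣ A ∣ →
    (k : ℕ) → 1 ≤ k →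
    3 * ((2 * ∣ A ∣ ^ k) ⊓ (p ∸ 1)) ≤ 16 * ∣ Aseq p A k ∣
lemma9 p p-prime _ A 5≤∣A∣ =
  Growth.bound (λ k → ∣ Aseq p A k ∣) 5≤∣A∣ (∣p∣≤n A) refl
    (Iteration.Aseq-step p p-prime A (ℕ.≤-trans (ℕ.s≤s (ℕ.s≤s ℕ.z≤n)) 5≤∣A∣))
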